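{- Let $n\geq 6$ and let $i$ be an integer with $\lfloor n/3\rfloor+2\leq i\leq \lfloor n/2\rfloor$. Then $$d_a(C_n,i)\geq \sum_{k=3}^{i-1}(k+2)\,d(P_{n-k-2},i-k).$$
   Context: $C_n$ denotes the cycle on $n$ vertices and $P_m$ the path on $m$ vertices. A dominating set of a graph $G=(V,E)$ is a set $D\subseteq V$ such that every vertex not in $D$ is adjacent to some vertex of $D$. A dominating set $D$ is accurate if no $|D|$-element subset of $V\setminus D$ is a dominating set of $G$. $d(G,j)$ is the number of dominating sets of $G$ of cardinality $j$ and $d_a(G,j)$ the number of accurate dominating sets of $G$ of cardinality $j$. Empty sums are $0$. -}

module Defs where

open import Data.Nat using (ℕ; zero; suc; _+_; _∸_)
open import Data.Nat.Properties using (_≟_)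
open import Data.Fin using (Fin; toℕ)
open import Data.Fin.Properties using (all?; any?)
open import Data.Fin.Subset using (Subset; _∈_; _∉_; _⊆_; ∁; ∣_∣; inside; outside)
open import Data.Fin.Subset.Properties using (_∈?_; _⊆?_; anySubset?)
open import Data.Vec using ([]; _∷_)
open import Data.List using (upTo; map)
open import Data.Nat.ListAction using (sum)
open import Data.Product using (Σ; ∃; _×_; _,_)
open import Data.Sum using (_⊎_)
open import Relation.Nullary using (Dec; yes; no; ¬_)
open import Relation.Nullary.Decidable using (¬?; _×-dec_; _⊎-dec_; _→-dec_)
open import Relation.Binary.PropositionalEquality using (_≡_)

record Graph (n : ℕ) : Set₁ where
  field
    Adj  : Fin n → Fin n → Set
    adj? : ∀ u v → Dec (Adj u v)
open Graph public

PathAdj : (m : ℕ) → Fin m → Fin m → Set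
PathAdj m i j = suc (toℕ i) ≡ toℕ j ⊎ suc (toℕ j) ≡ toℕ i

CycleAdj : (n : ℕ) → Fin n → Fin n → Set
CycleAdj n i j =
  PathAdj n i j ⊎ ((toℕ i ≡ 0 × suc (toℕ j) ≡ n) ⊎ (toℕ j ≡ 0 × suc (toℕ i) ≡ n))

P : (m : ℕ) → Graph m
P m = record
  { Adj = PathAdj m
  ; adj? = λ i j → (suc (toℕ i) ≟ toℕ j) ⊎-dec (suc (toℕ j) ≟ toℕ i) }

C : (n : ℕ) → Graph n
C n = record
  { Adj = CycleAdj n
  ; adj? = λ i j → Graph.adj? (P n) i j ⊎-dec
      (((toℕ i ≟ 0) ×-dec (suc (toℕ j) ≟ n)) ⊎-dec ((toℕ j ≟ 0) ×-dec (suc (toℕ i) ≟ n))) }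

Dominating : ∀ {n} → Graph n → Subset n → Set
Dominating G D = ∀ v → v ∉ D → ∃ λ u → u ∈ D × Adj G u v

dominating? : ∀ {n} (G : Graph n) (D : Subset n) → Dec (Dominating G D)
dominating? G D = all? λ v → ¬? (v ∈? D) →-dec any? (λ u → (u ∈? D) ×-dec adj? G u v)

Accurate : ∀ {n} → Graph n → Subset n → Set
Accurate G D = Dominating G D ×
  ¬ (∃ λ S → S ⊆ ∁ D × ∣ S ∣ ≡ ∣ D ∣ × Dominating G S)

accurate? : ∀ {n} (G : Graph n) (D : Subset n) → Dec (Accurate G D)
accurate? G D = dominating? G D ×-dec
  ¬? (anySubset? λ S → (S ⊆? ∁ D) ×-dec ((∣ S ∣ ≟ ∣ D ∣) ×-dec dominating? G S))

countSubsets : ∀ {n} {Q : Subset n → Set} → (∀ S → Dec (Q S)) → ℕ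
countSubsets {zero} Q? with Q? []
... | yes _ = 1
... | no  _ = 0
countSubsets {suc n} Q? =
  countSubsets (λ S → Q? (inside ∷ S)) + countSubsets (λ S → Q? (outside ∷ S))

d : ∀ {n} → Graph n → ℕ → ℕ
d G j = countSubsets (λ S → (∣ S ∣ ≟ j) ×-dec dominating? G S)

dₐ : ∀ {n} → Graph n → ℕ → ℕ
dₐ G j = countSubsets (λ S → (∣ S ∣ ≟ j) ×-dec accurate? G S)

-- ∑_{k = lo}^{hi} f k  (empty, i.e. 0, when hi < lo).
sumFromTo : ℕ → ℕ → (ℕ → ℕ) → ℕ
sumFromTo lo hi f = sum (map (λ t → f (lo + t)) (upTo (suc hi ∸ lo)))

-- Double counting.  Call a k-block of S ⊆ C_n a maximal run of k consecutive vertices of S.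
-- Writing a dominating set of P_(n-k-2) of size i - k after the pattern ○●…●○ (k dots) gives a
-- dominating set of C_n of size i with a k-block in a fixed place, so, over all n rotations,
-- n · d(P_(n-k-2), i-k) is at most the number of pairs (S, c) with S a dominating set of size i
-- having a k-block right after c.  A dominating set S with a k-block, k ≥ 3, is accurate: the
-- middle one of three consecutive vertices of S has its closed neighbourhood inside S, so no set
-- disjoint from S dominates it.  Blocks are disjoint, so the numbers X_k of k-blocks of S satisfy
-- ∑ k X_k ≤ |S| = i; since 3 (k + 2) ≤ 5 k for k ≥ 3 and 2 i ≤ n, every accurate S of size i is
-- counted with total weight ∑_(k≥3) (k + 2) X_k ≤ 5 i / 3 ≤ n.  Dividing by n gives the bound.

module Submission where

open import Defs
open import Data.Bool.Properties using () renaming (_≟_ to _≟ᵇ_)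
open import Data.Fin using (Fin; toℕ; fromℕ<; zero; suc)
open import Data.Fin.Properties using (toℕ-fromℕ<; toℕ<n)
open import Data.Fin.Subset using (Subset; Side; ∣_∣; inside; outside; _∈_; _∉_; ∁)
open import Data.Fin.Subset.Properties using (x∈∁p⇒x∉p)
open import Data.List using (map; applyUpTo)
open import Data.Nat using (ℕ; zero; suc; _+_; _∸_; _*_; _/_; _≤_; _<_; _<?_; z≤n; s≤s; z<s; s<s)
open import Data.Nat.ListAction using (sum)
open import Data.Nat.Tactic.RingSolver using (solve-∀)
open import Data.Nat.Properties
open import Data.Nat.DivMod
  using (_%_; m%n<n; m<n⇒m%n≡m; [m+n]%n≡m%n; [m+kn]%n≡m%n; m%n%n≡m%n; n%n≡0; %-distribˡ-+; m/n*n≤m)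
open import Algebra.Properties.CommutativeSemigroup +-commutativeSemigroup
  using (interchange) renaming (x∙yz≈y∙xz to m+[n+o]≡n+[m+o]; xy∙z≈xz∙y to m+n+o≡m+o+n)
open import Algebra.Properties.CommutativeSemigroup *-commutativeSemigroup
  using () renaming (x∙yz≈y∙xz to m*[n*o]≡n*[m*o])
open import Data.Product using (_×_; _,_; ∃; proj₁; proj₂)
open import Data.Sum using (_⊎_; inj₁; inj₂)
open import Data.Vec using ([]; _∷_; _++_; _∷ʳ_; lookup; tabulate; replicate)
open import Data.Vec.Properties using ([]=⇒lookup; lookup⇒[]=)
open import Function using (_∘_)
open import Relation.Binary.PropositionalEquality
open import Relation.Nullary using (Dec; yes; no; ¬_; contradiction)
open import Relation.Nullary.Decidable using (map′; _×-dec_)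
open import Relation.Binary.Definitions using (tri<; tri≈; tri>)

∑< : ℕ → (ℕ → ℕ) → ℕ
∑< zero    f = 0
∑< (suc n) f = f 0 + ∑< n (f ∘ suc)

syntax ∑< n (λ x → e) = ∑[ x < n ] e

∑-cong : ∀ n {f g} → (∀ {x} → x < n → f x ≡ g x) → ∑< n f ≡ ∑< n g
∑-cong zero    f≡g = refl
∑-cong (suc n) f≡g = cong₂ _+_ (f≡g z<s) (∑-cong n (f≡g ∘ s<s))

∑-mono-≤ : ∀ n {f g} → (∀ {x} → x < n → f x ≤ g x) → ∑< n f ≤ ∑< n g
∑-mono-≤ zero    f≤g = z≤n
∑-mono-≤ (suc n) f≤g = +-mono-≤ (f≤g z<s) (∑-mono-≤ n (f≤g ∘ s<s))

∑-zero : ∀ n {f} → (∀ {x} → x < n → f x ≡ 0) → ∑< n f ≡ 0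
∑-zero zero    f≡0 = refl
∑-zero (suc n) f≡0 = cong₂ _+_ (f≡0 z<s) (∑-zero n (f≡0 ∘ s<s))

∑-const : ∀ n a → ∑[ _ < n ] a ≡ n * a
∑-const zero    a = refl
∑-const (suc n) a = cong (a +_) (∑-const n a)

∑-snoc : ∀ n f → ∑< (suc n) f ≡ ∑< n f + f n
∑-snoc zero    f = +-comm (f 0) 0
∑-snoc (suc n) f = trans (cong (f 0 +_) (∑-snoc n (f ∘ suc))) (sym (+-assoc (f 0) _ _))

∑-distrib-+ : ∀ n f g → ∑[ x < n ] (f x + g x) ≡ ∑< n f + ∑< n g
∑-distrib-+ zero    f g = refl
∑-distrib-+ (suc n) f g =
  trans (cong (f 0 + g 0 +_) (∑-distrib-+ n (f ∘ suc) (g ∘ suc))) (interchange (f 0) (g 0) _ _)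

∑-*-distribˡ : ∀ n a f → ∑[ x < n ] (a * f x) ≡ a * ∑< n f
∑-*-distribˡ zero    a f = sym (*-zeroʳ a)
∑-*-distribˡ (suc n) a f =
  trans (cong (a * f 0 +_) (∑-*-distribˡ n a (f ∘ suc))) (sym (*-distribˡ-+ a (f 0) _))

∑-comm : ∀ m n (f : ℕ → ℕ → ℕ) → ∑[ x < m ] ∑[ y < n ] f x y ≡ ∑[ y < n ] ∑[ x < m ] f x y
∑-comm zero    n f = sym (∑-zero n λ _ → refl)
∑-comm (suc m) n f =
  trans (cong (∑< n (f 0) +_) (∑-comm m n (f ∘ suc))) (sym (∑-distrib-+ n (f 0) _))

∑-rotate-periodic : ∀ n f → (∀ x → f (x + n) ≡ f x) → ∀ a → ∑[ x < n ] f (x + a) ≡ ∑< n f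
∑-rotate-periodic n f periodic zero = ∑-cong n λ {x} _ → cong f (+-identityʳ x)
∑-rotate-periodic n f periodic (suc a) = begin
  ∑[ x < n ] f (x + suc a)  ≡⟨ ∑-cong n (λ {x} _ → cong f (+-suc x a)) ⟩
  ∑[ x < n ] f (suc x + a)  ≡⟨ +-cancelˡ-≡ (f a) _ _ rotate-once ⟩
  ∑[ x < n ] f (x + a)      ≡⟨ ∑-rotate-periodic n f periodic a ⟩
  ∑< n f                    ∎
  where
  open ≡-Reasoning
  rotate-once : f a + ∑[ x < n ] f (suc x + a) ≡ f a + ∑[ x < n ] f (x + a)
  rotate-once = begin
    ∑[ x < suc n ] f (x + a)     ≡⟨ ∑-snoc n (λ x → f (x + a)) ⟩
    ∑[ x < n ] f (x + a) + f (n + a) ≡⟨ cong (∑[ x < n ] f (x + a) +_) (trans (cong f (+-comm n a)) (periodic a)) ⟩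
    ∑[ x < n ] f (x + a) + f a   ≡⟨ +-comm _ (f a) ⟩
    f a + ∑[ x < n ] f (x + a)   ∎

∑≢0⇒∃≢0 : ∀ n f → ∑< n f ≢ 0 → ∃ λ x → x < n × f x ≢ 0
∑≢0⇒∃≢0 zero    f ∑≢0 = contradiction refl ∑≢0
∑≢0⇒∃≢0 (suc n) f ∑≢0 with f 0 ≟ 0
... | no  f0≢0 = 0 , z<s , f0≢0
... | yes f0≡0 =
  let x , x<n , fx≢0 = ∑≢0⇒∃≢0 n (f ∘ suc) (λ ∑≡0 → ∑≢0 (cong₂ _+_ f0≡0 ∑≡0))
  in suc x , s<s x<n , fx≢0

∑≤-unique-nonzero : ∀ n {f} B → (∀ {x} → x < n → f x ≤ B) →
  (∀ {x y} → x < n → y < n → f x ≢ 0 → f y ≢ 0 → x ≡ y) → ∑< n f ≤ B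
∑≤-unique-nonzero zero    B _     _      = z≤n
∑≤-unique-nonzero (suc n) {f} B bound unique with f 0 ≟ 0
... | yes f0≡0 = subst (_≤ B) (cong (_+ ∑< n (f ∘ suc)) (sym f0≡0))
                   (∑≤-unique-nonzero n B (bound ∘ s<s) λ x<n y<n fx≢0 fy≢0 →
                     suc-injective (unique (s<s x<n) (s<s y<n) fx≢0 fy≢0))
... | no  f0≢0 = begin
  f 0 + ∑< n (f ∘ suc) ≡⟨ cong (f 0 +_) (∑-zero n tail≡0) ⟩
  f 0 + 0              ≡⟨ +-identityʳ (f 0) ⟩
  f 0                  ≤⟨ bound z<s ⟩
  B                    ∎
  where
  open ≤-Reasoning
  tail≡0 : ∀ {x} → x < n → f (suc x) ≡ 0
  tail≡0 {x} x<n with f (suc x) ≟ 0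
  ... | yes fx≡0 = fx≡0
  ... | no  fx≢0 = contradiction (unique z<s (s<s x<n) f0≢0 fx≢0) 0≢1+n

sumFromTo≡∑ : ∀ lo hi f → sumFromTo lo hi f ≡ ∑[ t < suc hi ∸ lo ] f (lo + t)
sumFromTo≡∑ lo hi f = sum-applyUpTo (suc hi ∸ lo) (λ t → t)
  where
  sum-applyUpTo : ∀ L g → sum (map (λ t → f (lo + t)) (applyUpTo g L)) ≡ ∑[ t < L ] f (lo + g t)
  sum-applyUpTo zero    g = refl
  sum-applyUpTo (suc L) g = cong (f (lo + g 0) +_) (sum-applyUpTo L (g ∘ suc))

𝟙 : ∀ {a} {A : Set a} → Dec A → ℕ
𝟙 (yes _) = 1
𝟙 (no  _) = 0

𝟙-yes : ∀ {a} {A : Set a} (A? : Dec A) → A → 𝟙 A? ≡ 1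
𝟙-yes (yes _) _ = refl
𝟙-yes (no ¬a) a = contradiction a ¬a

𝟙≢0⇒ : ∀ {a} {A : Set a} (A? : Dec A) → 𝟙 A? ≢ 0 → A
𝟙≢0⇒ (yes a) _   = a
𝟙≢0⇒ (no  _) 1≢0 = contradiction refl 1≢0

𝟙-mono-≤ : ∀ {a b} {A : Set a} {B : Set b} (A? : Dec A) (B? : Dec B) → (A → B) → 𝟙 A? ≤ 𝟙 B?
𝟙-mono-≤ (yes a) B? A⇒B = ≤-reflexive (sym (𝟙-yes B? (A⇒B a)))
𝟙-mono-≤ (no  _) B? A⇒B = z≤n

𝟙-cong : ∀ {a b} {A : Set a} {B : Set b} (A? : Dec A) (B? : Dec B) → (A → B) → (B → A) → 𝟙 A? ≡ 𝟙 B?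
𝟙-cong A? B? A⇒B B⇒A = ≤-antisym (𝟙-mono-≤ A? B? A⇒B) (𝟙-mono-≤ B? A? B⇒A)

∑ˢ : ∀ {n} → (Subset n → ℕ) → ℕ
∑ˢ {zero}  f = f []
∑ˢ {suc n} f = ∑ˢ (f ∘ (inside ∷_)) + ∑ˢ (f ∘ (outside ∷_))

countSubsets≡∑ˢ𝟙 : ∀ {n} {Q : Subset n → Set} (Q? : ∀ S → Dec (Q S)) → countSubsets Q? ≡ ∑ˢ (𝟙 ∘ Q?)
countSubsets≡∑ˢ𝟙 {zero} Q? with Q? []
... | yes _ = refl
... | no  _ = refl
countSubsets≡∑ˢ𝟙 {suc n} Q? =
  cong₂ _+_ (countSubsets≡∑ˢ𝟙 (Q? ∘ (inside ∷_))) (countSubsets≡∑ˢ𝟙 (Q? ∘ (outside ∷_)))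

∑ˢ-cong : ∀ {n} {f g : Subset n → ℕ} → (∀ S → f S ≡ g S) → ∑ˢ f ≡ ∑ˢ g
∑ˢ-cong {zero}  f≡g = f≡g []
∑ˢ-cong {suc n} f≡g = cong₂ _+_ (∑ˢ-cong (f≡g ∘ (inside ∷_))) (∑ˢ-cong (f≡g ∘ (outside ∷_)))

∑ˢ-mono-≤ : ∀ {n} {f g : Subset n → ℕ} → (∀ S → f S ≤ g S) → ∑ˢ f ≤ ∑ˢ g
∑ˢ-mono-≤ {zero}  f≤g = f≤g []
∑ˢ-mono-≤ {suc n} f≤g = +-mono-≤ (∑ˢ-mono-≤ (f≤g ∘ (inside ∷_))) (∑ˢ-mono-≤ (f≤g ∘ (outside ∷_)))

∑ˢ-*-distribˡ : ∀ {n} a (f : Subset n → ℕ) → ∑ˢ (λ S → a * f S) ≡ a * ∑ˢ f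
∑ˢ-*-distribˡ {zero}  a f = refl
∑ˢ-*-distribˡ {suc n} a f =
  trans (cong₂ _+_ (∑ˢ-*-distribˡ a (f ∘ (inside ∷_))) (∑ˢ-*-distribˡ a (f ∘ (outside ∷_))))
        (sym (*-distribˡ-+ a _ _))

∑ˢ-distrib-+ : ∀ {n} (f g : Subset n → ℕ) → ∑ˢ (λ S → f S + g S) ≡ ∑ˢ f + ∑ˢ g
∑ˢ-distrib-+ {zero}  f g = refl
∑ˢ-distrib-+ {suc n} f g =
  trans (cong₂ _+_ (∑ˢ-distrib-+ (f ∘ (inside ∷_)) (g ∘ (inside ∷_)))
                   (∑ˢ-distrib-+ (f ∘ (outside ∷_)) (g ∘ (outside ∷_))))
        (interchange (∑ˢ (f ∘ (inside ∷_))) (∑ˢ (g ∘ (inside ∷_))) (∑ˢ (f ∘ (outside ∷_))) (∑ˢ (g ∘ (outside ∷_))))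

∑ˢ-zero : ∀ {n} → ∑ˢ {n} (λ _ → 0) ≡ 0
∑ˢ-zero {zero}  = refl
∑ˢ-zero {suc n} = cong₂ _+_ (∑ˢ-zero {n}) (∑ˢ-zero {n})

∑ˢ-∑-comm : ∀ {n} L (f : ℕ → Subset n → ℕ) → ∑ˢ (λ S → ∑[ t < L ] f t S) ≡ ∑[ t < L ] ∑ˢ (f t)
∑ˢ-∑-comm {n} zero f = ∑ˢ-zero {n}
∑ˢ-∑-comm (suc L) f = trans (∑ˢ-distrib-+ (f 0) _) (cong (∑ˢ (f 0) +_) (∑ˢ-∑-comm L (f ∘ suc)))

∑ˢ-++ : ∀ {a b} (f : Subset (a + b) → ℕ) → ∑ˢ f ≡ ∑ˢ {a} (λ u → ∑ˢ {b} (λ v → f (u ++ v)))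
∑ˢ-++ {zero}  f = refl
∑ˢ-++ {suc a} f = cong₂ _+_ (∑ˢ-++ {a} (f ∘ (inside ∷_))) (∑ˢ-++ {a} (f ∘ (outside ∷_)))

∑ˢ-∷ʳ : ∀ {n} (f : Subset (suc n) → ℕ) → ∑ˢ f ≡ ∑ˢ (λ S → f (S ∷ʳ inside)) + ∑ˢ (λ S → f (S ∷ʳ outside))
∑ˢ-∷ʳ {zero}  f = refl
∑ˢ-∷ʳ {suc n} f =
  trans (cong₂ _+_ (∑ˢ-∷ʳ (f ∘ (inside ∷_))) (∑ˢ-∷ʳ (f ∘ (outside ∷_))))
        (interchange (∑ˢ (λ S → f (inside ∷ (S ∷ʳ inside)))) (∑ˢ (λ S → f (inside ∷ (S ∷ʳ outside))))
                     (∑ˢ (λ S → f (outside ∷ (S ∷ʳ inside)))) (∑ˢ (λ S → f (outside ∷ (S ∷ʳ outside)))))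

term≤∑ˢ : ∀ {n} (f : Subset n → ℕ) S → f S ≤ ∑ˢ f
term≤∑ˢ f []            = ≤-refl
term≤∑ˢ f (inside  ∷ S) = ≤-trans (term≤∑ˢ (f ∘ (inside ∷_)) S) (m≤m+n _ _)
term≤∑ˢ f (outside ∷ S) = ≤-trans (term≤∑ˢ (f ∘ (outside ∷_)) S) (m≤n+m _ _)

closedNeighbourhood⊆⇒accurate : ∀ {n} (G : Graph n) {D} v → v ∈ D → (∀ u → Adj G u v → u ∈ D) →
  Dominating G D → Accurate G D
closedNeighbourhood⊆⇒accurate G v v∈D N⊆D D-dom = D-dom , λ (S , S⊆∁D , _ , S-dom) →
  let u , u∈S , u~v = S-dom v (λ v∈S → x∈∁p⇒x∉p (S⊆∁D v∈S) v∈D)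
  in  x∈∁p⇒x∉p (S⊆∁D u∈S) (N⊆D u u~v)

∉⇒outside : ∀ {n} {S : Subset n} {v} → v ∉ S → lookup S v ≡ outside
∉⇒outside {S = S} {v} v∉S with lookup S v in eq
... | inside  = contradiction (lookup⇒[]= v S eq) v∉S
... | outside = refl

outside⇒∉ : ∀ {n} (S : Subset n) v → lookup S v ≡ outside → v ∉ S
outside⇒∉ S v eq v∈S with trans (sym eq) ([]=⇒lookup v∈S)
... | ()

bit : Side → ℕ
bit inside  = 1
bit outside = 0

lookupℕ : ∀ {n} → Subset n → ℕ → Side
lookupℕ []      _       = outside
lookupℕ (b ∷ S) zero    = b
lookupℕ (b ∷ S) (suc x) = lookupℕ S x

lookupℕ-toℕ : ∀ {n} (S : Subset n) v → lookupℕ S (toℕ v) ≡ lookup S v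
lookupℕ-toℕ (b ∷ S) zero    = refl
lookupℕ-toℕ (b ∷ S) (suc v) = lookupℕ-toℕ S v

lookupℕ-tabulate : ∀ n (f : ℕ → Side) {x} → x < n → lookupℕ (tabulate {n = n} (f ∘ toℕ)) x ≡ f x
lookupℕ-tabulate (suc n) f {zero}  _         = refl
lookupℕ-tabulate (suc n) f {suc x} (s<s x<n) = lookupℕ-tabulate n (f ∘ suc) x<n

lookupℕ-ext : ∀ {n} (S T : Subset n) → (∀ {x} → x < n → lookupℕ S x ≡ lookupℕ T x) → S ≡ T
lookupℕ-ext []      []      _   = refl
lookupℕ-ext (a ∷ S) (b ∷ T) S≗T = cong₂ _∷_ (S≗T z<s) (lookupℕ-ext S T (S≗T ∘ s<s))

lookupℕ-++ˡ : ∀ {a b} (S : Subset a) (T : Subset b) {x} → x < a → lookupℕ (S ++ T) x ≡ lookupℕ S x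
lookupℕ-++ˡ (c ∷ S) T {zero}  _         = refl
lookupℕ-++ˡ (c ∷ S) T {suc x} (s<s x<a) = lookupℕ-++ˡ S T x<a

lookupℕ-++ʳ : ∀ {a b} (S : Subset a) (T : Subset b) y → lookupℕ (S ++ T) (a + y) ≡ lookupℕ T y
lookupℕ-++ʳ []      T y = refl
lookupℕ-++ʳ (c ∷ S) T y = lookupℕ-++ʳ S T y

lookupℕ-∷ʳ-< : ∀ {n} (S : Subset n) b {x} → x < n → lookupℕ (S ∷ʳ b) x ≡ lookupℕ S x
lookupℕ-∷ʳ-< (c ∷ S) b {zero}  _         = refl
lookupℕ-∷ʳ-< (c ∷ S) b {suc x} (s<s x<n) = lookupℕ-∷ʳ-< S b x<n

lookupℕ-∷ʳ-last : ∀ {n} (S : Subset n) b → lookupℕ (S ∷ʳ b) n ≡ b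
lookupℕ-∷ʳ-last []      b = refl
lookupℕ-∷ʳ-last (c ∷ S) b = lookupℕ-∷ʳ-last S b

∣S∣≡∑bit : ∀ {n} (S : Subset n) → ∣ S ∣ ≡ ∑[ x < n ] bit (lookupℕ S x)
∣S∣≡∑bit []            = refl
∣S∣≡∑bit (inside  ∷ S) = cong suc (∣S∣≡∑bit S)
∣S∣≡∑bit (outside ∷ S) = ∣S∣≡∑bit S

∣S++T∣ : ∀ {a b} (S : Subset a) (T : Subset b) → ∣ S ++ T ∣ ≡ ∣ S ∣ + ∣ T ∣
∣S++T∣ []            T = refl
∣S++T∣ (inside  ∷ S) T = cong suc (∣S++T∣ S T)
∣S++T∣ (outside ∷ S) T = ∣S++T∣ S T

record Block (s : ℕ → Side) (k : ℕ) : Set where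
  field
    before : s 0 ≡ outside
    within : ∀ {t} → t < k → s (suc t) ≡ inside
    after  : s (suc k) ≡ outside

block? : ∀ s k → Dec (Block s k)
block? s k = map′ (λ (b , w , a) → record { before = b ; within = λ {t} → w {t} ; after = a })
                  (λ B → Block.before B , (λ {t} → Block.within B {t}) , Block.after B)
                  (s 0 ≟ᵇ outside ×-dec allUpTo? (λ t → s (suc t) ≟ᵇ inside) k ×-dec s (suc k) ≟ᵇ outside)

Block-cong : ∀ {s s'} k → (∀ x → s x ≡ s' x) → Block s k → Block s' k
Block-cong k s≗s' B = record
  { before = trans (sym (s≗s' 0)) before
  ; within = λ t<k → trans (sym (s≗s' _)) (within t<k)
  ; after  = trans (sym (s≗s' _)) after
  }
  where open Block B

Block-length-unique : ∀ {s k k'} → Block s k → Block s k' → k ≡ k'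
Block-length-unique {k = k} {k'} B B' with <-cmp k k'
... | tri< k<k' _ _ = contradiction (trans (sym (Block.after B)) (Block.within B' k<k')) λ ()
... | tri≈ _ k≡k' _ = k≡k'
... | tri> _ _ k'<k = contradiction (trans (sym (Block.after B')) (Block.within B k'<k)) λ ()

weighted-sum≤ : ∀ L (X : ℕ → ℕ) {i n} → ∑[ k < 3 + L ] (k * X k) ≤ i → 2 * i ≤ n →
  ∑[ t < L ] ((3 + t + 2) * X (3 + t)) ≤ n
weighted-sum≤ L X {i} {n} ∑kX≤i 2i≤n = *-cancelˡ-≤ 3 (begin
  3 * ∑[ t < L ] ((3 + t + 2) * X (3 + t))   ≡⟨ ∑-*-distribˡ L 3 _ ⟨
  ∑[ t < L ] (3 * ((3 + t + 2) * X (3 + t))) ≤⟨ ∑-mono-≤ L (λ {t} _ → weight≤ t (X (3 + t))) ⟩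
  ∑[ t < L ] (5 * ((3 + t) * X (3 + t)))     ≡⟨ ∑-*-distribˡ L 5 _ ⟩
  5 * ∑[ t < L ] ((3 + t) * X (3 + t))       ≤⟨ *-monoʳ-≤ 5 (≤-trans (m≤n+m _ (2 * X 2)) (m≤n+m _ (1 * X 1))) ⟩
  5 * ∑[ k < 3 + L ] (k * X k)               ≤⟨ *-monoʳ-≤ 5 ∑kX≤i ⟩
  5 * i                                      ≤⟨ *-monoˡ-≤ i (n≤1+n 5) ⟩
  6 * i                                      ≡⟨ *-assoc 3 2 i ⟩
  3 * (2 * i)                                ≤⟨ *-monoʳ-≤ 3 2i≤n ⟩
  3 * n                                      ∎)
  where
  open ≤-Reasoning
  weight≤ : ∀ t x → 3 * ((3 + t + 2) * x) ≤ 5 * ((3 + t) * x)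
  weight≤ t x = subst₂ _≤_ (lhs t x) (rhs t x)
    (*-monoˡ-≤ x (+-monoʳ-≤ 15 (*-monoˡ-≤ t {3} {5} (s≤s (s≤s (s≤s z≤n))))))
    where
    lhs : ∀ t x → (15 + 3 * t) * x ≡ 3 * ((3 + t + 2) * x)
    lhs = solve-∀
    rhs : ∀ t x → (15 + 5 * t) * x ≡ 5 * ((3 + t) * x)
    rhs = solve-∀

module Cycle (n' : ℕ) where

  n : ℕ
  n = suc n'

  at : Subset n → ℕ → Side
  at S x = lookupℕ S (x % n)

  at-+n : ∀ S x → at S (x + n) ≡ at S x
  at-+n S x = cong (lookupℕ S) ([m+n]%n≡m%n x n)

  at-+*n : ∀ S x q → at S (x + q * n) ≡ at S x
  at-+*n S x q = cong (lookupℕ S) ([m+kn]%n≡m%n x q n)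

  at-< : ∀ S {x} → x < n → at S x ≡ lookupℕ S x
  at-< S x<n = cong (lookupℕ S) (m<n⇒m%n≡m x<n)

  at-toℕ : ∀ S v → at S (toℕ v) ≡ lookup S v
  at-toℕ S v = trans (at-< S (toℕ<n v)) (lookupℕ-toℕ S v)

  at-%-+ : ∀ S a b → at S (a % n + b) ≡ at S (a + b)
  at-%-+ S a b = cong (lookupℕ S) (begin
    (a % n + b) % n           ≡⟨ %-distribˡ-+ (a % n) b n ⟩
    (a % n % n + b % n) % n   ≡⟨ cong (λ r → (r + b % n) % n) (m%n%n≡m%n a n) ⟩
    (a % n + b % n) % n       ≡⟨ %-distribˡ-+ a b n ⟨
    (a + b) % n               ∎)
    where open ≡-Reasoning

  at-+-% : ∀ S a b → at S (a + b % n) ≡ at S (a + b)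
  at-+-% S a b = begin
    at S (a + b % n)  ≡⟨ cong (at S) (+-comm a (b % n)) ⟩
    at S (b % n + a)  ≡⟨ at-%-+ S b a ⟩
    at S (b + a)      ≡⟨ cong (at S) (+-comm b a) ⟩
    at S (a + b)      ∎
    where open ≡-Reasoning

  vertex : ℕ → Fin n
  vertex x = fromℕ< (m%n<n x n)

  toℕ-vertex : ∀ x → toℕ (vertex x) ≡ x % n
  toℕ-vertex x = toℕ-fromℕ< (m%n<n x n)

  lookup-vertex : ∀ S x → lookup S (vertex x) ≡ at S x
  lookup-vertex S x = trans (sym (lookupℕ-toℕ S (vertex x))) (cong (lookupℕ S) (toℕ-vertex x))

  neighbour-at : ∀ (S : Subset n) {u v} → CycleAdj n u v →
    lookup S u ≡ at S (suc (toℕ v)) ⊎ lookup S u ≡ at S (toℕ v + n')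
  neighbour-at S {u} {v} (inj₁ (inj₁ u+1≡v)) = inj₂ (begin
    lookup S u                 ≡⟨ at-toℕ S u ⟨
    at S (toℕ u)               ≡⟨ at-+n S (toℕ u) ⟨
    at S (toℕ u + n)           ≡⟨ cong (at S) (+-suc (toℕ u) n') ⟩
    at S (suc (toℕ u) + n')    ≡⟨ cong (λ y → at S (y + n')) u+1≡v ⟩
    at S (toℕ v + n')          ∎)
    where open ≡-Reasoning
  neighbour-at S {u} (inj₁ (inj₂ v+1≡u)) = inj₁ (trans (sym (at-toℕ S u)) (cong (at S) (sym v+1≡u)))
  neighbour-at S {u} {v} (inj₂ (inj₁ (u≡0 , v+1≡n))) = inj₁ (begin
    lookup S u           ≡⟨ at-toℕ S u ⟨
    at S (toℕ u)         ≡⟨ cong (at S) u≡0 ⟩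
    at S 0               ≡⟨ at-+n S 0 ⟨
    at S n               ≡⟨ cong (at S) v+1≡n ⟨
    at S (suc (toℕ v))   ∎)
    where open ≡-Reasoning
  neighbour-at S {u} {v} (inj₂ (inj₂ (v≡0 , u+1≡n))) = inj₂ (begin
    lookup S u           ≡⟨ at-toℕ S u ⟨
    at S (toℕ u)         ≡⟨ cong (at S) (suc-injective u+1≡n) ⟩
    at S n'              ≡⟨ cong (λ y → at S (y + n')) v≡0 ⟨
    at S (toℕ v + n')    ∎)
    where open ≡-Reasoning

  successor-adjacent : ∀ v → CycleAdj n (vertex (suc (toℕ v))) v
  successor-adjacent v with m≤n⇒m<n∨m≡n (toℕ<n v)
  ... | inj₁ v+1<n = inj₁ (inj₂ (sym (trans (toℕ-vertex (suc (toℕ v))) (m<n⇒m%n≡m v+1<n))))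
  ... | inj₂ v+1≡n = inj₂ (inj₁ (trans (toℕ-vertex (suc (toℕ v))) (trans (cong (_% n) v+1≡n) (n%n≡0 n)) , v+1≡n))

  predecessor-adjacent : ∀ v → CycleAdj n (vertex (toℕ v + n')) v
  predecessor-adjacent v with toℕ v in v≡
  ... | zero  = inj₂ (inj₂ (refl , cong suc (trans (toℕ-vertex n') (m<n⇒m%n≡m ≤-refl))))
  ... | suc w = inj₁ (inj₁ (cong suc (begin
    toℕ (vertex (suc w + n'))  ≡⟨ toℕ-vertex (suc w + n') ⟩
    (suc w + n') % n           ≡⟨ cong (_% n) (+-suc w n') ⟨
    (w + n) % n                ≡⟨ [m+n]%n≡m%n w n ⟩
    w % n                      ≡⟨ m<n⇒m%n≡m (<-trans (n<1+n w) (subst (_< n) v≡ (toℕ<n v))) ⟩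
    w                          ∎)))
    where open ≡-Reasoning

  -- n' is −1 modulo n, so x + n' is the predecessor of x.
  Dominated : (ℕ → Side) → ℕ → Set
  Dominated s x = s x ≡ outside → s (suc x) ≡ inside ⊎ s (x + n') ≡ inside

  dominating⇒dominated : ∀ (S : Subset n) → Dominating (C n) S → ∀ x → Dominated (at S) x
  dominating⇒dominated S S-dom x x∉S
    with u , u∈S , u~x ← S-dom (vertex x) (outside⇒∉ S (vertex x) (trans (lookup-vertex S x) x∉S))
    with neighbour-at S u~x
  ... | inj₁ eq = inj₁ (begin
    at S (suc x)                   ≡⟨ at-+-% S 1 x ⟨
    at S (suc (x % n))             ≡⟨ cong (λ y → at S (suc y)) (toℕ-vertex x) ⟨
    at S (suc (toℕ (vertex x)))    ≡⟨ eq ⟨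
    lookup S u                     ≡⟨ []=⇒lookup u∈S ⟩
    inside                         ∎)
    where open ≡-Reasoning
  ... | inj₂ eq = inj₂ (begin
    at S (x + n')                  ≡⟨ at-%-+ S x n' ⟨
    at S (x % n + n')              ≡⟨ cong (λ y → at S (y + n')) (toℕ-vertex x) ⟨
    at S (toℕ (vertex x) + n')     ≡⟨ eq ⟨
    lookup S u                     ≡⟨ []=⇒lookup u∈S ⟩
    inside                         ∎)
    where open ≡-Reasoning

  dominated⇒dominating : ∀ (S : Subset n) → (∀ {x} → x < n → Dominated (at S) x) → Dominating (C n) S
  dominated⇒dominating S dom v v∉S with dom (toℕ<n v) (trans (at-toℕ S v) (∉⇒outside v∉S))
  ... | inj₁ eq = _ , lookup⇒[]= _ S (trans (lookup-vertex S (suc (toℕ v))) eq) , successor-adjacent v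
  ... | inj₂ eq = _ , lookup⇒[]= _ S (trans (lookup-vertex S (toℕ v + n')) eq) , predecessor-adjacent v

  three-consecutive⇒accurate : ∀ (S : Subset n) c → Dominating (C n) S →
    (∀ {t} → t < 3 → at S (c + suc t) ≡ inside) → Accurate (C n) S
  three-consecutive⇒accurate S c S-dom c+1…c+3∈S =
    closedNeighbourhood⊆⇒accurate (C n) v (lookup⇒[]= v S (trans (lookup-vertex S (c + 2)) (c+1…c+3∈S (s<s z<s))))
      (λ u u~v → lookup⇒[]= u S (neighbour∈S (neighbour-at S u~v))) S-dom
    where
    open ≡-Reasoning
    v : Fin n
    v = vertex (c + 2)
    neighbour∈S : ∀ {u} → lookup S u ≡ at S (suc (toℕ v)) ⊎ lookup S u ≡ at S (toℕ v + n') →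
      lookup S u ≡ inside
    neighbour∈S {u} (inj₁ eq) = begin
      lookup S u                 ≡⟨ eq ⟩
      at S (suc (toℕ v))         ≡⟨ cong (λ y → at S (suc y)) (toℕ-vertex (c + 2)) ⟩
      at S (1 + (c + 2) % n)     ≡⟨ at-+-% S 1 (c + 2) ⟩
      at S (suc (c + 2))         ≡⟨ cong (at S) (+-suc c 2) ⟨
      at S (c + 3)               ≡⟨ c+1…c+3∈S ≤-refl ⟩
      inside                     ∎
    neighbour∈S {u} (inj₂ eq) = begin
      lookup S u                 ≡⟨ eq ⟩
      at S (toℕ v + n')          ≡⟨ cong (λ y → at S (y + n')) (toℕ-vertex (c + 2)) ⟩
      at S ((c + 2) % n + n')    ≡⟨ at-%-+ S (c + 2) n' ⟩
      at S (c + 2 + n')          ≡⟨ cong (at S) (back c n') ⟩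
      at S (c + 1 + n)           ≡⟨ at-+n S (c + 1) ⟩
      at S (c + 1)               ≡⟨ c+1…c+3∈S z<s ⟩
      inside                     ∎
      where
      back : ∀ c m → c + 2 + m ≡ c + 1 + suc m
      back = solve-∀

  rotate : ℕ → Subset n → Subset n
  rotate c S = tabulate (λ j → at S (c + toℕ j))

  lookupℕ-rotate : ∀ c S {x} → x < n → lookupℕ (rotate c S) x ≡ at S (c + x)
  lookupℕ-rotate c S = lookupℕ-tabulate n (λ y → at S (c + y))

  at-rotate : ∀ c S x → at (rotate c S) x ≡ at S (c + x)
  at-rotate c S x = trans (lookupℕ-rotate c S (m%n<n x n)) (at-+-% S c x)

  rotate-zero : ∀ S → rotate 0 S ≡ S
  rotate-zero S = lookupℕ-ext _ S λ x<n → trans (lookupℕ-rotate 0 S x<n) (at-< S x<n)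

  rotate-suc : ∀ c S → rotate (suc c) S ≡ rotate 1 (rotate c S)
  rotate-suc c S = lookupℕ-ext _ _ λ {x} x<n → begin
    lookupℕ (rotate (suc c) S) x   ≡⟨ lookupℕ-rotate (suc c) S x<n ⟩
    at S (suc c + x)               ≡⟨ cong (at S) (+-suc c x) ⟨
    at S (c + suc x)               ≡⟨ at-rotate c S (suc x) ⟨
    at (rotate c S) (1 + x)        ≡⟨ lookupℕ-rotate 1 (rotate c S) x<n ⟨
    lookupℕ (rotate 1 (rotate c S)) x ∎
    where open ≡-Reasoning

  rotate-one-∷ : ∀ b S → rotate 1 (b ∷ S) ≡ S ∷ʳ b
  rotate-one-∷ b S = lookupℕ-ext _ _ λ {x} x<n → trans (lookupℕ-rotate 1 (b ∷ S) x<n) (shifted x<n)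
    where
    shifted : ∀ {x} → x < n → at (b ∷ S) (suc x) ≡ lookupℕ (S ∷ʳ b) x
    shifted {x} (s≤s x≤n') with m≤n⇒m<n∨m≡n x≤n'
    ... | inj₁ x<n' = trans (at-< (b ∷ S) (s<s x<n')) (sym (lookupℕ-∷ʳ-< S b x<n'))
    ... | inj₂ refl = trans (cong (lookupℕ (b ∷ S)) (n%n≡0 n)) (sym (lookupℕ-∷ʳ-last S b))

  ∑ˢ-rotate : ∀ c (f : Subset n → ℕ) → ∑ˢ (f ∘ rotate c) ≡ ∑ˢ f
  ∑ˢ-rotate zero    f = ∑ˢ-cong (cong f ∘ rotate-zero)
  ∑ˢ-rotate (suc c) f = begin
    ∑ˢ (f ∘ rotate (suc c))           ≡⟨ ∑ˢ-cong (cong f ∘ rotate-suc c) ⟩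
    ∑ˢ (f ∘ rotate 1 ∘ rotate c)      ≡⟨ ∑ˢ-rotate c (f ∘ rotate 1) ⟩
    ∑ˢ (f ∘ rotate 1)                 ≡⟨ cong₂ _+_ (∑ˢ-cong (cong f ∘ rotate-one-∷ inside))
                                                   (∑ˢ-cong (cong f ∘ rotate-one-∷ outside)) ⟩
    ∑ˢ (λ S → f (S ∷ʳ inside)) + ∑ˢ (λ S → f (S ∷ʳ outside)) ≡⟨ ∑ˢ-∷ʳ f ⟨
    ∑ˢ f                              ∎
    where open ≡-Reasoning

  ∑-rotations-∑ˢ : ∀ (f : Subset n → ℕ) → ∑ˢ (λ S → ∑[ c < n ] f (rotate c S)) ≡ n * ∑ˢ f
  ∑-rotations-∑ˢ f = begin
    ∑ˢ (λ S → ∑[ c < n ] f (rotate c S))  ≡⟨ ∑ˢ-∑-comm n (λ c → f ∘ rotate c) ⟩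
    ∑[ c < n ] ∑ˢ (f ∘ rotate c)           ≡⟨ ∑-cong n (λ {c} _ → ∑ˢ-rotate c f) ⟩
    ∑[ c < n ] ∑ˢ f                        ≡⟨ ∑-const n (∑ˢ f) ⟩
    n * ∑ˢ f                               ∎
    where open ≡-Reasoning

  ∣S∣≡∑bit-at : ∀ S → ∣ S ∣ ≡ ∑[ x < n ] bit (at S x)
  ∣S∣≡∑bit-at S = trans (∣S∣≡∑bit S) (∑-cong n λ x<n → cong bit (sym (at-< S x<n)))

  ∣rotate∣ : ∀ c S → ∣ rotate c S ∣ ≡ ∣ S ∣
  ∣rotate∣ c S = begin
    ∣ rotate c S ∣                      ≡⟨ ∣S∣≡∑bit-at (rotate c S) ⟩
    ∑[ x < n ] bit (at (rotate c S) x)  ≡⟨ ∑-cong n (λ {x} _ →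
                                             cong bit (trans (at-rotate c S x) (cong (at S) (+-comm c x)))) ⟩
    ∑[ x < n ] bit (at S (x + c))       ≡⟨ ∑-rotate-periodic n (bit ∘ at S) (cong bit ∘ at-+n S) c ⟩
    ∑[ x < n ] bit (at S x)             ≡⟨ ∣S∣≡∑bit-at S ⟨
    ∣ S ∣                               ∎
    where open ≡-Reasoning

  -- x + c * n' is x − c modulo n.
  at-rotate-back : ∀ c S x → at (rotate c S) (x + c * n') ≡ at S x
  at-rotate-back c S x = begin
    at (rotate c S) (x + c * n')  ≡⟨ at-rotate c S (x + c * n') ⟩
    at S (c + (x + c * n'))       ≡⟨ cong (at S) (m+[n+o]≡n+[m+o] c x (c * n')) ⟩
    at S (x + (c + c * n'))       ≡⟨ cong (λ y → at S (x + y)) (*-suc c n') ⟨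
    at S (x + c * n)              ≡⟨ at-+*n S x c ⟩
    at S x                        ∎
    where open ≡-Reasoning

  rotate-dominating : ∀ c S → Dominating (C n) (rotate c S) → Dominating (C n) S
  rotate-dominating c S R-dom = dominated⇒dominating S λ {x} _ x∉S →
    Data.Sum.map (next x) (prev x)
      (dominating⇒dominated (rotate c S) R-dom (x + c * n') (trans (at-rotate-back c S x) x∉S))
    where
    next : ∀ x → at (rotate c S) (suc x + c * n') ≡ inside → at S (suc x) ≡ inside
    next x = trans (sym (at-rotate-back c S (suc x)))
    prev : ∀ x → at (rotate c S) (x + c * n' + n') ≡ inside → at S (x + n') ≡ inside
    prev x = trans (sym (trans (cong (at (rotate c S)) (m+n+o≡m+o+n x (c * n') n')) (at-rotate-back c S (x + n'))))

  blockAt : Subset n → ℕ → ℕ → ℕ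
  blockAt S k c = 𝟙 (block? (λ x → at S (c + x)) k)

  blockAt-periodic : ∀ S k c → blockAt S k (c + n) ≡ blockAt S k c
  blockAt-periodic S k c = 𝟙-cong (block? _ k) (block? _ k) (Block-cong k shift) (Block-cong k (sym ∘ shift))
    where
    shift : ∀ x → at S (c + n + x) ≡ at S (c + x)
    shift x = trans (cong (at S) (m+n+o≡m+o+n c n x)) (at-+n S (c + x))

  -- v + n' * suc j is v − (j + 1) modulo n, so such a block covers v when j < k.
  Covering : Subset n → ℕ → ℕ → ℕ → Set
  Covering S v j k = Block (λ x → at S (v + n' * suc j + x)) k

  covering⇒inside : ∀ S v {j k} → j < k → Covering S v j k → at S v ≡ inside
  covering⇒inside S v {j} j<k B = begin
    at S v                          ≡⟨ at-+*n S v (suc j) ⟨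
    at S (v + suc j * n)            ≡⟨ cong (at S) (cover v n' j) ⟨
    at S (v + n' * suc j + suc j)   ≡⟨ Block.within B j<k ⟩
    inside                          ∎
    where
    open ≡-Reasoning
    cover : ∀ v m j → v + m * suc j + suc j ≡ v + suc j * suc m
    cover = solve-∀

  -- The start of the block for j would lie inside the block for j'.
  covering-start-unique : ∀ S v {j k j' k'} → j < j' → j' < k' → Covering S v j k → ¬ Covering S v j' k'
  covering-start-unique S v {j} j<j' j'<k' B B' with m≤n⇒∃[o]m+o≡n j<j'
  ... | e , refl = contradiction (begin
    outside                                    ≡⟨ Block.before B ⟨
    at S (v + n' * suc j + 0)                  ≡⟨ at-+*n S (v + n' * suc j + 0) (suc e) ⟨
    at S (v + n' * suc j + 0 + suc e * n)      ≡⟨ cong (at S) (nested v n' j e) ⟨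
    at S (v + n' * suc (suc j + e) + suc e)    ≡⟨ Block.within B' (<-trans (s≤s (m≤n+m e j)) j'<k') ⟩
    inside                                     ∎) λ ()
    where
    open ≡-Reasoning
    nested : ∀ v m j e → v + m * suc (suc j + e) + suc e ≡ v + m * suc j + 0 + suc e * suc m
    nested = solve-∀

  covering-unique : ∀ S v {j k j' k'} → j < k → j' < k' → Covering S v j k → Covering S v j' k' →
    j ≡ j' × k ≡ k'
  covering-unique S v {j} {k} {j'} {k'} j<k j'<k' B B' with <-cmp j j'
  ... | tri< j<j' _ _ = contradiction B' (covering-start-unique S v j<j' j'<k' B)
  ... | tri≈ _ refl _ = refl , Block-length-unique B B'
  ... | tri> _ _ j'<j = contradiction B (covering-start-unique S v j'<j j<k B')

  coverings≤bit : ∀ S K v → ∑[ k < K ] ∑[ j < k ] blockAt S k (v + n' * suc j) ≤ bit (at S v)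
  coverings≤bit S K v = ∑≤-unique-nonzero K (bit (at S v))
    (λ {k} _ → ∑≤-unique-nonzero k (bit (at S v)) covering≤bit
      λ j<k j'<k B≢0 B'≢0 → proj₁ (covering-unique S v j<k j'<k (𝟙≢0⇒ (block? _ k) B≢0) (𝟙≢0⇒ (block? _ k) B'≢0)))
    λ {k} {k'} _ _ ∑≢0 ∑'≢0 →
      let j  , j<k   , B≢0  = ∑≢0⇒∃≢0 k  _ ∑≢0
          j' , j'<k' , B'≢0 = ∑≢0⇒∃≢0 k' _ ∑'≢0
      in  proj₂ (covering-unique S v j<k j'<k' (𝟙≢0⇒ (block? _ k) B≢0) (𝟙≢0⇒ (block? _ k') B'≢0))
    where
    covering≤bit : ∀ {j k} → j < k → blockAt S k (v + n' * suc j) ≤ bit (at S v)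
    covering≤bit {j} {k} j<k with block? (λ x → at S (v + n' * suc j + x)) k
    ... | yes B = ≤-reflexive (cong bit (sym (covering⇒inside S v j<k B)))
    ... | no  _ = z≤n

  -- Every element of S lies in at most one maximal block.
  ∑-block-lengths≤∣S∣ : ∀ S K → ∑[ k < K ] (k * ∑[ c < n ] blockAt S k c) ≤ ∣ S ∣
  ∑-block-lengths≤∣S∣ S K = begin
    ∑[ k < K ] (k * ∑[ c < n ] blockAt S k c)
      ≡⟨ ∑-cong K (λ {k} _ → sym (∑-const k _)) ⟩
    ∑[ k < K ] ∑[ j < k ] ∑[ c < n ] blockAt S k c
      ≡⟨ ∑-cong K (λ {k} _ → ∑-cong k λ {j} _ →
           sym (∑-rotate-periodic n (blockAt S k) (blockAt-periodic S k) (n' * suc j))) ⟩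
    ∑[ k < K ] ∑[ j < k ] ∑[ v < n ] blockAt S k (v + n' * suc j)
      ≡⟨ ∑-cong K (λ {k} _ → ∑-comm k n λ j v → blockAt S k (v + n' * suc j)) ⟩
    ∑[ k < K ] ∑[ v < n ] ∑[ j < k ] blockAt S k (v + n' * suc j)
      ≡⟨ ∑-comm K n (λ k v → ∑[ j < k ] blockAt S k (v + n' * suc j)) ⟩
    ∑[ v < n ] ∑[ k < K ] ∑[ j < k ] blockAt S k (v + n' * suc j)
      ≤⟨ ∑-mono-≤ n (λ {v} _ → coverings≤bit S K v) ⟩
    ∑[ v < n ] bit (at S v)
      ≡⟨ ∣S∣≡∑bit-at S ⟨
    ∣ S ∣ ∎
    where open ≤-Reasoning

  DominatingWithBlock : ℕ → ℕ → Subset n → Set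
  DominatingWithBlock i k R = Block (at R) k × ∣ R ∣ ≡ i × Dominating (C n) R

  dominatingWithBlock? : ∀ i k R → Dec (DominatingWithBlock i k R)
  dominatingWithBlock? i k R = block? (at R) k ×-dec (∣ R ∣ ≟ i) ×-dec dominating? (C n) R

  accurateOfSize? : ∀ i S → Dec (∣ S ∣ ≡ i × Accurate (C n) S)
  accurateOfSize? i S = (∣ S ∣ ≟ i) ×-dec accurate? (C n) S

  rotated-block⇒accurate : ∀ {i k} c S → 3 ≤ k → DominatingWithBlock i k (rotate c S) →
    ∣ S ∣ ≡ i × Accurate (C n) S
  rotated-block⇒accurate c S 3≤k (B , ∣R∣≡i , R-dom) =
    trans (sym (∣rotate∣ c S)) ∣R∣≡i ,
    three-consecutive⇒accurate S c (rotate-dominating c S R-dom) λ t<3 →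
      trans (sym (at-rotate c S (suc _))) (Block.within B (<-≤-trans t<3 3≤k))

  rotated-block⇒block : ∀ {i k} c S → DominatingWithBlock i k (rotate c S) → Block (λ x → at S (c + x)) k
  rotated-block⇒block c S (B , _) = Block-cong _ (at-rotate c S) B

  ∑-rotations≤ : ∀ i L S → 2 * i ≤ n →
    ∑[ t < L ] ((3 + t + 2) * ∑[ c < n ] 𝟙 (dominatingWithBlock? i (3 + t) (rotate c S)))
      ≤ n * 𝟙 (accurateOfSize? i S)
  ∑-rotations≤ i L S 2i≤n with accurateOfSize? i S
  ... | yes (∣S∣≡i , _) = begin
    ∑[ t < L ] ((3 + t + 2) * ∑[ c < n ] 𝟙 (dominatingWithBlock? i (3 + t) (rotate c S)))
      ≤⟨ ∑-mono-≤ L (λ {t} _ → *-monoʳ-≤ (3 + t + 2) (∑-mono-≤ n λ {c} _ →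
           𝟙-mono-≤ (dominatingWithBlock? i (3 + t) (rotate c S)) (block? _ (3 + t)) (rotated-block⇒block c S))) ⟩
    ∑[ t < L ] ((3 + t + 2) * ∑[ c < n ] blockAt S (3 + t) c)
      ≤⟨ weighted-sum≤ L (λ k → ∑[ c < n ] blockAt S k c)
           (subst (_ ≤_) ∣S∣≡i (∑-block-lengths≤∣S∣ S (3 + L))) 2i≤n ⟩
    n         ≡⟨ *-identityʳ n ⟨
    n * 1     ∎
    where open ≤-Reasoning
  ... | no ¬acc = ≤-reflexive (trans (∑-zero L λ {t} _ → trans (cong ((3 + t + 2) *_) (∑-zero n λ {c} _ →
                    n≤0⇒n≡0 (𝟙-mono-≤ (dominatingWithBlock? i (3 + t) (rotate c S)) (no ¬acc)
                                      (rotated-block⇒accurate c S (m≤m+n 3 t)))))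
                    (*-zeroʳ (3 + t + 2)))
                  (sym (*-zeroʳ n)))

blockPattern : ∀ k → Subset (2 + k)
blockPattern k = outside ∷ (replicate k inside ∷ʳ outside)

blockPattern-within : ∀ k {t} → t < k → lookupℕ (blockPattern k) (suc t) ≡ inside
blockPattern-within k {t} t<k = trans (lookupℕ-∷ʳ-< (replicate k inside) outside t<k) (ones k t<k)
  where
  ones : ∀ k {t} → t < k → lookupℕ (replicate k inside) t ≡ inside
  ones (suc k) {zero}  _         = refl
  ones (suc k) {suc t} (s<s t<k) = ones k t<k

blockPattern-last : ∀ {k} → 1 ≤ k → lookupℕ (blockPattern k) k ≡ inside
blockPattern-last {suc k} _ = blockPattern-within (suc k) ≤-refl

blockPattern-after : ∀ k → lookupℕ (blockPattern k) (suc k) ≡ outside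
blockPattern-after k = lookupℕ-∷ʳ-last (replicate k inside) outside

∣blockPattern∣ : ∀ k → ∣ blockPattern k ∣ ≡ k
∣blockPattern∣ zero    = refl
∣blockPattern∣ (suc k) = cong suc (∣blockPattern∣ k)

module Gluing (k m : ℕ) where

  n' : ℕ
  n' = suc (k + m)

  open Cycle n'

  glue : Subset m → Subset n
  glue T = blockPattern k ++ T

  at-glue-pattern : ∀ T {x} → x < 2 + k → at (glue T) x ≡ lookupℕ (blockPattern k) x
  at-glue-pattern T x<2+k =
    trans (at-< (glue T) (<-≤-trans x<2+k (m≤m+n (2 + k) m))) (lookupℕ-++ˡ (blockPattern k) T x<2+k)

  at-glue-path : ∀ T {y} → y < m → at (glue T) (2 + k + y) ≡ lookupℕ T y
  at-glue-path T y<m = trans (at-< (glue T) (+-monoʳ-< (2 + k) y<m)) (lookupℕ-++ʳ (blockPattern k) T _)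

  at-glue-member : ∀ T {u} → u ∈ T → at (glue T) (2 + k + toℕ u) ≡ inside
  at-glue-member T {u} u∈T = trans (at-glue-path T (toℕ<n u)) (trans (lookupℕ-toℕ T u) ([]=⇒lookup u∈T))

  glue-block : ∀ T → Block (at (glue T)) k
  glue-block T = record
    { before = at-glue-pattern T z<s
    ; within = λ t<k → trans (at-glue-pattern T (s<s (m<n⇒m<1+n t<k))) (blockPattern-within k t<k)
    ; after  = trans (at-glue-pattern T ≤-refl) (blockPattern-after k)
    }

  ∣glue∣ : ∀ T → ∣ glue T ∣ ≡ k + ∣ T ∣
  ∣glue∣ T = trans (∣S++T∣ (blockPattern k) T) (cong (_+ ∣ T ∣) (∣blockPattern∣ k))

  pattern-dominated : ∀ T → 1 ≤ k → ∀ {x} → x < 2 + k → Dominated (at (glue T)) x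
  pattern-dominated T 1≤k {zero} _ _ = inj₁ (Block.within (glue-block T) 1≤k)
  pattern-dominated T 1≤k {suc t} (s≤s (s≤s t≤k)) t∉ with m≤n⇒m<n∨m≡n t≤k
  ... | inj₁ t<k  = contradiction (trans (sym t∉) (Block.within (glue-block T) t<k)) λ ()
  ... | inj₂ refl = inj₂ (begin
    at (glue T) (suc k + n')   ≡⟨ cong (at (glue T)) (+-suc k n') ⟨
    at (glue T) (k + n)        ≡⟨ at-+n (glue T) k ⟩
    at (glue T) k              ≡⟨ at-glue-pattern T (m<n⇒m<1+n (n<1+n k)) ⟩
    lookupℕ (blockPattern k) k ≡⟨ blockPattern-last 1≤k ⟩
    inside                     ∎)
    where open ≡-Reasoning

  path-dominated : ∀ T → Dominating (P m) T → ∀ {y} → y < m → Dominated (at (glue T)) (2 + k + y)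
  path-dominated T T-dom {y} y<m y∉
    with u , u∈T , u~y ← T-dom (fromℕ< y<m)
           (outside⇒∉ T _ (trans (sym (lookupℕ-toℕ T _))
             (trans (cong (lookupℕ T) (toℕ-fromℕ< y<m)) (trans (sym (at-glue-path T y<m)) y∉))))
    with u~y
  ... | inj₁ u+1≡y = inj₂ (begin
    at (glue T) (2 + k + y + n')          ≡⟨ cong (λ z → at (glue T) (2 + k + z + n'))
                                                  (trans (sym (toℕ-fromℕ< y<m)) (sym u+1≡y)) ⟩
    at (glue T) (2 + k + suc (toℕ u) + n') ≡⟨ cong (at (glue T)) (shift k (toℕ u) n') ⟩
    at (glue T) (2 + k + toℕ u + n)       ≡⟨ at-+n (glue T) (2 + k + toℕ u) ⟩
    at (glue T) (2 + k + toℕ u)           ≡⟨ at-glue-member T u∈T ⟩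
    inside                                ∎)
    where
    open ≡-Reasoning
    shift : ∀ k u m → 2 + k + suc u + m ≡ 2 + k + u + suc m
    shift = solve-∀
  ... | inj₂ y+1≡u = inj₁ (begin
    at (glue T) (suc (2 + k + y))   ≡⟨ cong (at (glue T)) (+-suc (2 + k) y) ⟨
    at (glue T) (2 + k + suc y)     ≡⟨ cong (λ z → at (glue T) (2 + k + suc z)) (toℕ-fromℕ< y<m) ⟨
    at (glue T) (2 + k + suc (toℕ (fromℕ< y<m))) ≡⟨ cong (λ z → at (glue T) (2 + k + z)) y+1≡u ⟩
    at (glue T) (2 + k + toℕ u)     ≡⟨ at-glue-member T u∈T ⟩
    inside                          ∎)
    where open ≡-Reasoning

  glue-dominating : ∀ T → 1 ≤ k → Dominating (P m) T → Dominating (C n) (glue T)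
  glue-dominating T 1≤k T-dom = dominated⇒dominating (glue T) dominated
    where
    dominated : ∀ {x} → x < n → Dominated (at (glue T)) x
    dominated {x} x<n with x <? 2 + k
    ... | yes x<2+k = pattern-dominated T 1≤k x<2+k
    ... | no  x≮2+k = subst (Dominated (at (glue T))) x≡2+k+y
                        (path-dominated T T-dom (+-cancelˡ-< (2 + k) _ m (subst (_< n) (sym x≡2+k+y) x<n)))
      where
      x≡2+k+y : 2 + k + (x ∸ (2 + k)) ≡ x
      x≡2+k+y = m+[n∸m]≡n (≮⇒≥ x≮2+k)

  d-path≤ : ∀ i → 1 ≤ k → k ≤ i → d (P m) (i ∸ k) ≤ ∑ˢ (𝟙 ∘ dominatingWithBlock? i k)
  d-path≤ i 1≤k k≤i = begin
    d (P m) (i ∸ k)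
      ≡⟨ countSubsets≡∑ˢ𝟙 (λ T → (∣ T ∣ ≟ i ∸ k) ×-dec dominating? (P m) T) ⟩
    ∑ˢ (λ T → 𝟙 ((∣ T ∣ ≟ i ∸ k) ×-dec dominating? (P m) T))
      ≤⟨ ∑ˢ-mono-≤ (λ T → 𝟙-mono-≤ ((∣ T ∣ ≟ i ∸ k) ×-dec dominating? (P m) T) (dominatingWithBlock? i k (glue T))
           λ (∣T∣≡i-k , T-dom) → glue-block T , trans (∣glue∣ T) (trans (cong (k +_) ∣T∣≡i-k) (m+[n∸m]≡n k≤i)) ,
                                 glue-dominating T 1≤k T-dom) ⟩
    ∑ˢ (λ T → 𝟙 (dominatingWithBlock? i k (glue T)))
      ≤⟨ term≤∑ˢ (λ u → ∑ˢ {m} (λ T → 𝟙 (dominatingWithBlock? i k (u ++ T)))) (blockPattern k) ⟩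
    ∑ˢ {2 + k} (λ u → ∑ˢ {m} (λ T → 𝟙 (dominatingWithBlock? i k (u ++ T))))
      ≡⟨ ∑ˢ-++ {2 + k} {m} (𝟙 ∘ dominatingWithBlock? i k) ⟨
    ∑ˢ (𝟙 ∘ dominatingWithBlock? i k) ∎
    where open ≤-Reasoning

d-path≤∑ˢdominatingWithBlock : ∀ {n'} i k m → suc (k + m) ≡ n' → 1 ≤ k → k ≤ i →
  d (P m) (i ∸ k) ≤ ∑ˢ (𝟙 ∘ Cycle.dominatingWithBlock? n' i k)
d-path≤∑ˢdominatingWithBlock i k m refl = Gluing.d-path≤ k m i

module DoubleCounting (n' i : ℕ) (2i≤n : 2 * i ≤ suc n') where
  open Cycle n'

  L : ℕ
  L = suc (i ∸ 1) ∸ 3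

  blocked : ℕ → Subset n → ℕ
  blocked k S = ∑[ c < n ] 𝟙 (dominatingWithBlock? i k (rotate c S))

  pathTerm : ℕ → ℕ
  pathTerm k = (k + 2) * d (P (n ∸ k ∸ 2)) (i ∸ k)

  n*pathTerm≤ : ∀ {t} → t < L → n * pathTerm (3 + t) ≤ ∑ˢ (λ S → (3 + t + 2) * blocked (3 + t) S)
  n*pathTerm≤ {t} t<L = begin
    n * ((k + 2) * d (P m) (i ∸ k))      ≡⟨ m*[n*o]≡n*[m*o] n (k + 2) (d (P m) (i ∸ k)) ⟩
    (k + 2) * (n * d (P m) (i ∸ k))      ≤⟨ *-monoʳ-≤ (k + 2) (*-monoʳ-≤ n
                                              (d-path≤∑ˢdominatingWithBlock i k m path-length z<s (<⇒≤ k<i))) ⟩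
    (k + 2) * (n * ∑ˢ (𝟙 ∘ dominatingWithBlock? i k))
                                         ≡⟨ cong ((k + 2) *_) (∑-rotations-∑ˢ (𝟙 ∘ dominatingWithBlock? i k)) ⟨
    (k + 2) * ∑ˢ (blocked k)             ≡⟨ ∑ˢ-*-distribˡ (k + 2) (blocked k) ⟨
    ∑ˢ (λ S → (k + 2) * blocked k S)     ∎
    where
    open ≤-Reasoning
    k m : ℕ
    k = 3 + t
    m = n ∸ k ∸ 2
    k<i : k < i
    k<i = range i t<L
      where
      range : ∀ i {t} → t < suc (i ∸ 1) ∸ 3 → 3 + t < i
      range (suc (suc (suc (suc i)))) t<L = s≤s (s≤s (s≤s t<L))
    k+2≤n : k + 2 ≤ n
    k+2≤n = begin
      k + 2      ≡⟨ +-comm k 2 ⟩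
      1 + suc k  ≤⟨ +-mono-≤ (≤-trans (s≤s z≤n) k<i) k<i ⟩
      i + i      ≡⟨ cong (i +_) (+-identityʳ i) ⟨
      2 * i      ≤⟨ 2i≤n ⟩
      n          ∎
    path-length : suc (k + m) ≡ n'
    path-length = suc-injective (begin-equality
      2 + k + m            ≡⟨ cong (_+ m) (+-comm 2 k) ⟩
      k + 2 + m            ≡⟨ cong (k + 2 +_) (∸-+-assoc n k 2) ⟩
      k + 2 + (n ∸ (k + 2)) ≡⟨ m+[n∸m]≡n k+2≤n ⟩
      n                    ∎)

  weightedBlocked : Subset n → ℕ
  weightedBlocked S = ∑[ t < L ] ((3 + t + 2) * blocked (3 + t) S)

  n*∑pathTerm≤∑ˢweightedBlocked : n * ∑[ t < L ] pathTerm (3 + t) ≤ ∑ˢ weightedBlocked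
  n*∑pathTerm≤∑ˢweightedBlocked = begin
    n * ∑[ t < L ] pathTerm (3 + t)                        ≡⟨ ∑-*-distribˡ L n (pathTerm ∘ (3 +_)) ⟨
    ∑[ t < L ] (n * pathTerm (3 + t))                      ≤⟨ ∑-mono-≤ L n*pathTerm≤ ⟩
    ∑[ t < L ] ∑ˢ (λ S → (3 + t + 2) * blocked (3 + t) S)  ≡⟨ ∑ˢ-∑-comm L (λ t S → (3 + t + 2) * blocked (3 + t) S) ⟨
    ∑ˢ weightedBlocked                                     ∎
    where open ≤-Reasoning

  ∑ˢweightedBlocked≤n*dₐ : ∑ˢ weightedBlocked ≤ n * dₐ (C n) i
  ∑ˢweightedBlocked≤n*dₐ = begin
    ∑ˢ weightedBlocked                      ≤⟨ ∑ˢ-mono-≤ (λ S → ∑-rotations≤ i L S 2i≤n) ⟩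
    ∑ˢ (λ S → n * 𝟙 (accurateOfSize? i S))  ≡⟨ ∑ˢ-*-distribˡ n (𝟙 ∘ accurateOfSize? i) ⟩
    n * ∑ˢ (𝟙 ∘ accurateOfSize? i)           ≡⟨ cong (n *_) (countSubsets≡∑ˢ𝟙 (accurateOfSize? i)) ⟨
    n * dₐ (C n) i                           ∎
    where open ≤-Reasoning

i≤n/2⇒2i≤n : ∀ {i n} → i ≤ n / 2 → 2 * i ≤ n
i≤n/2⇒2i≤n {i} {n} i≤n/2 = ≤-trans (*-monoʳ-≤ 2 i≤n/2) (subst (_≤ n) (*-comm (n / 2) 2) (m/n*n≤m n 2))

theorem4p4 : (n i : ℕ) → 6 ≤ n → n / 3 + 2 ≤ i → i ≤ n / 2 →
    sumFromTo 3 (i ∸ 1) (λ k → (k + 2) * d (P (n ∸ k ∸ 2)) (i ∸ k)) ≤ dₐ (C n) i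
theorem4p4 n@(suc n') i _ _ i≤n/2 = *-cancelˡ-≤ n (begin
  n * sumFromTo 3 (i ∸ 1) pathTerm                          ≡⟨ cong (n *_) (sumFromTo≡∑ 3 (i ∸ 1) pathTerm) ⟩
  n * ∑[ t < L ] pathTerm (3 + t)                           ≤⟨ n*∑pathTerm≤∑ˢweightedBlocked ⟩
  ∑ˢ weightedBlocked                                        ≤⟨ ∑ˢweightedBlocked≤n*dₐ ⟩
  n * dₐ (C n) i                                            ∎)
  where
  open ≤-Reasoning
  open DoubleCounting n' i (i≤n/2⇒2i≤n i≤n/2)
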